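{- Let $G$ be a graph. (i) $G$ is $1$-CFON$^*$-colorable if and only if $G$ is $1$-CFON$^*$-choosable. (ii) $G$ is $1$-CFCN$^*$-colorable if and only if $G$ is $1$-CFCN$^*$-choosable.
   Context: Graphs are finite, simple, undirected (for open-neighborhood notions, without isolated vertices). For a list assignment $\mathcal{L}=\{L_v\}$, an $\mathcal{L}$-CFON$^*$-coloring (resp. $\mathcal{L}$-CFCN$^*$-coloring) is a map $f:V'\to\bigcup_{v\in V'}L_v$ on some subset $V'\subseteq V(G)$ with $f(v)\in L_v$ for $v\in V'$, such that every vertex $v\in V(G)$ has a color appearing on exactly one vertex of its open neighborhood $N_G(v)$ (resp. closed neighborhood $N_G[v]=N_G(v)\cup\{v\}$). $G$ is $k$-CFON$^*$-choosable (resp. $k$-CFCN$^*$-choosable) if such a coloring exists for every assignment with $|L_v|=k$ for all $v$. $G$ is $k$-CFON$^*$-colorable (resp. $k$-CFCN$^*$-colorable) if such a coloring exists for the particular assignment $L_v=\{1,\dots,k\}$ for all $v$. -}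

module Defs where

open import Data.Nat using (ℕ; suc)
open import Data.Fin using (Fin)
open import Data.List using (List; length; map; upTo)
open import Data.List.Membership.Propositional using (_∈_)
open import Data.List.Relation.Unary.Unique.Propositional using (Unique)
open import Data.Maybe using (Maybe; just)
open import Data.Product using (Σ; ∃; _×_)
open import Relation.Binary.PropositionalEquality using (_≡_)
open import Relation.Nullary using (¬_)

record Graph : Set₁ where
  field
    n       : ℕ
    Adj     : Fin n → Fin n → Set
    symm    : ∀ {u v} → Adj u v → Adj v u
    irrefl  : ∀ {v} → ¬ Adj v v

open Graph public

NoIsolated : Graph → Set
NoIsolated G = ∀ (v : Fin (n G)) → ∃ λ u → Adj G v u

InOpen : (G : Graph) → Fin (n G) → Fin (n G) → Set
InOpen G v u = Adj G v u

data InClosed (G : Graph) (v : Fin (n G)) : Fin (n G) → Set where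
  self : InClosed G v v
  nbr  : ∀ {u} → Adj G v u → InClosed G v u

ListAssignment : Graph → Set
ListAssignment G = Fin (n G) → List ℕ

-- A partial colouring f : V' → colours, V' = {v | f v ≢ nothing},
-- respecting the lists.
PartialColoring : Graph → Set
PartialColoring G = Fin (n G) → Maybe ℕ

RespectsLists : (G : Graph) → ListAssignment G → PartialColoring G → Set
RespectsLists G L f = ∀ v c → f v ≡ just c → c ∈ L v

UniqueColorIn : (G : Graph) → (Fin (n G) → Set) → PartialColoring G → Set
UniqueColorIn G N f =
  Σ ℕ λ c → Σ (Fin (n G)) λ u →
    N u × f u ≡ just c × (∀ w → N w → f w ≡ just c → w ≡ u)

IsCFON : (G : Graph) → ListAssignment G → PartialColoring G → Set
IsCFON G L f = RespectsLists G L f × (∀ v → UniqueColorIn G (InOpen G v) f)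

IsCFCN : (G : Graph) → ListAssignment G → PartialColoring G → Set
IsCFCN G L f = RespectsLists G L f × (∀ v → UniqueColorIn G (InClosed G v) f)

IsKAssignment : (G : Graph) → ℕ → ListAssignment G → Set
IsKAssignment G k L = ∀ v → length (L v) ≡ k × Unique (L v)

colours : ℕ → List ℕ
colours k = map suc (upTo k)

CFON-choosable : Graph → ℕ → Set
CFON-choosable G k = ∀ (L : ListAssignment G) → IsKAssignment G k L →
  ∃ λ f → IsCFON G L f

CFCN-choosable : Graph → ℕ → Set
CFCN-choosable G k = ∀ (L : ListAssignment G) → IsKAssignment G k L →
  ∃ λ f → IsCFCN G L f

CFON-colorable : Graph → ℕ → Set
CFON-colorable G k = ∃ λ f → IsCFON G (λ _ → colours k) f

CFCN-colorable : Graph → ℕ → Set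
CFCN-colorable G k = ∃ λ f → IsCFCN G (λ _ → colours k) f

-- With a single colour, a conflict-free colouring is determined by its support:
-- a neighbourhood has a uniquely coloured vertex iff it meets the support exactly
-- once. Given any 1-list assignment, recolour every vertex of the support with the
-- sole colour of its list; the support, and hence conflict-freeness, is unchanged.
-- Conversely, the lists {1} form a 1-list assignment.
module Submission where

open import Defs
open import Data.Nat using (ℕ)
open import Data.Fin using (Fin)
open import Data.List using (List; []; _∷_; length)
open import Data.List.Membership.Propositional using (_∈_)
open import Data.List.Relation.Unary.Any using (here)
open import Data.List.Relation.Unary.All using ([])
open import Data.List.Relation.Unary.AllPairs using ([]; _∷_)
open import Data.Maybe as Maybe using (just)
open import Data.Product using (∃; _×_; _,_; proj₁; proj₂)
open import Function.Bundles using (_⇔_; mk⇔)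
open import Relation.Binary.PropositionalEquality using (_≡_; refl; sym; trans; cong)

∈-colours-1 : ∀ {c} → c ∈ colours 1 → c ≡ 1
∈-colours-1 (here c≡1) = c≡1

length≡1⇒∃∈ : (xs : List ℕ) → length xs ≡ 1 → ∃ λ x → x ∈ xs
length≡1⇒∃∈ (x ∷ []) refl = x , here refl

colours-1-is-1-assignment : (G : Graph) → IsKAssignment G 1 (λ _ → colours 1)
colours-1-is-1-assignment G v = refl , [] ∷ []

module _ (G : Graph) where

  Monochromatic : ℕ → PartialColoring G → Set
  Monochromatic c f = ∀ v d → f v ≡ just d → d ≡ c

  recolour : (Fin (n G) → ℕ) → PartialColoring G → PartialColoring G
  recolour h f v = Maybe.map (λ _ → h v) (f v)

  recolour-just : ∀ h f {v c} → f v ≡ just c → recolour h f v ≡ just (h v)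
  recolour-just h f eq rewrite eq = refl

  recolour-just⁻ : ∀ h f v {d} → recolour h f v ≡ just d → ∃ λ c → f v ≡ just c
  recolour-just⁻ h f v eq with f v
  ... | just c = c , refl

  recolour-respects : ∀ {L} h f → (∀ v → h v ∈ L v) → RespectsLists G L (recolour h f)
  recolour-respects h f h∈L v d eq with f v
  recolour-respects h f h∈L v d refl | just _ = h∈L v

  recolour-unique : ∀ {N c} h f → Monochromatic c f →
    UniqueColorIn G N f → UniqueColorIn G N (recolour h f)
  recolour-unique h f mono (d , u , Nu , fu , unique) =
    h u , u , Nu , recolour-just h f fu , λ w Nw gw → unique w Nw (coloured-as-u w gw)
    where
    coloured-as-u : ∀ w → recolour h f w ≡ just (h u) → f w ≡ just d
    coloured-as-u w gw with recolour-just⁻ h f w gw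
    ... | e , fw = trans fw (cong just (trans (mono w e fw) (sym (mono u d fu))))

  colourable⇒choosable : (N : Fin (n G) → Fin (n G) → Set) →
    (∃ λ f → RespectsLists G (λ _ → colours 1) f × (∀ v → UniqueColorIn G (N v) f)) →
    (L : ListAssignment G) → IsKAssignment G 1 L →
    ∃ λ g → RespectsLists G L g × (∀ v → UniqueColorIn G (N v) g)
  colourable⇒choosable N (f , respects , unique) L K =
    recolour h f , recolour-respects h f h∈L , λ v → recolour-unique h f mono (unique v)
    where
    choice : ∀ v → ∃ λ x → x ∈ L v
    choice v = length≡1⇒∃∈ (L v) (proj₁ (K v))
    h : Fin (n G) → ℕ
    h v = proj₁ (choice v)
    h∈L : ∀ v → h v ∈ L v
    h∈L v = proj₂ (choice v)
    mono : Monochromatic 1 f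
    mono v d fv = ∈-colours-1 (respects v d fv)

proposition4 : (G : Graph) →
    (NoIsolated G → (CFON-colorable G 1 ⇔ CFON-choosable G 1))
    × (CFCN-colorable G 1 ⇔ CFCN-choosable G 1)
proposition4 G =
  (λ _ → mk⇔ (colourable⇒choosable G (InOpen G)) choosable⇒colourable)
  , mk⇔ (colourable⇒choosable G (InClosed G)) choosable⇒colourable
  where
  choosable⇒colourable : ∀ {A : ListAssignment G → Set} →
    (∀ L → IsKAssignment G 1 L → A L) → A (λ _ → colours 1)
  choosable⇒colourable choose = choose _ (colours-1-is-1-assignment G)
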